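{- Let $p$ be an odd prime, $a,m\in\mathbb Z_p$ with $m\not\equiv 0\pmod p$ and $a\not\equiv 0,-1\pmod p$. Put $c_k=\binom ak\binom{ -1-a}k\binom{2k}k$. Then $$2a(a+1)\sum_{k=0}^{p-2}\frac{c_k}{m^k(k+1)^2}\equiv(m-4)\sum_{k=0}^{p-1}\frac{kc_k}{m^k}+2\sum_{k=0}^{p-1}\frac{c_k}{m^k}+(4a(a+1)-2)\sum_{k=0}^{p-2}\frac{c_k}{m^k(k+1)}\pmod{p^3}$$ and $$2a(a+1)\sum_{k=0}^{p-2}\frac{c_k}{m^k(k+1)^3}\equiv -m+\Big(2m-8-\frac{m-4}{a(a+1)}\Big)\sum_{k=0}^{p-1}\frac{kc_k}{m^k}+\Big(m-\frac 2{a(a+1)}\Big)\sum_{k=0}^{p-1}\frac{c_k}{m^k}+\Big(8a(a+1)-2+\frac2{a(a+1)}\Big)\sum_{k=0}^{p-2}\frac{c_k}{m^k(k+1)}\pmod{p^3}.$$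
   Context: $\mathbb Z_p$ denotes the ring of rational numbers whose denominators are not divisible by $p$; congruences are in $\mathbb Z_p$. Generalized binomial coefficients: $\binom a0=1$, $\binom ak=\frac{a(a-1)\cdots(a-k+1)}{k!}$ for $k\ge1$. -}

module Defs where

open import Data.Nat as ℕ using (ℕ; zero; suc)
open import Data.Nat.Divisibility using (_∣_)
open import Data.Nat.Combinatorics using (_C_)
open import Data.Integer as ℤ using (ℤ; +_)
open import Data.Rational as ℚ using (ℚ; 0ℚ; 1ℚ; _+_; _*_; _-_; -_; 1/_; ≢-nonZero)
open import Data.Rational.Properties using (_≟_)
open import Data.Product using (Σ; _×_)
open import Relation.Nullary using (¬_; yes; no)
open import Relation.Binary.PropositionalEquality using (_≡_)

ι : ℕ → ℚ
ι n = (+ n) ℚ./ 1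

-- total inverse (1/0 := 0); only ever applied to nonzero rationals below
inv : ℚ → ℚ
inv q with q ≟ 0ℚ
... | yes _ = 0ℚ
... | no q≢0 = 1/_ q {{≢-nonZero q≢0}}

infixl 7 _÷_
_÷_ : ℚ → ℚ → ℚ
x ÷ y = x * inv y

infixr 8 _^_
_^_ : ℚ → ℕ → ℚ
x ^ zero = 1ℚ
x ^ suc n = x * (x ^ n)

InZp : ℕ → ℚ → Set
InZp p x = ¬ (p ∣ ℚ.denominatorℕ x)

Cong : ℕ → ℕ → ℚ → ℚ → Set
Cong p n x y = Σ ℚ (λ z → InZp p z × (x - y ≡ (ι p ^ n) * z))

falling : ℚ → ℕ → ℚ
falling a zero = 1ℚ
falling a (suc k) = falling a k * (a - ι k)

binom : ℚ → ℕ → ℚ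
binom a k = falling a k ÷ ι (k ℕ.!)

-- Σ_{k=0}^{n-1} f k
sumTo : ℕ → (ℕ → ℚ) → ℚ
sumTo zero f = 0ℚ
sumTo (suc n) f = sumTo n f + f n

c : ℚ → ℕ → ℚ
c a k = binom a k * binom (- 1ℚ - a) k * ι ((2 ℕ.* k) C k)

{-# OPTIONS --safe #-}
-- The ratio c (k+1) (k+1)³ = 2(2k+1)(a−k)(−1−a−k) c k makes the left minus the right
-- side of each congruence, with p − 1 replaced by n, telescope to an exact closed form:
-- (4n − 2) c n / mⁿ, resp. (8n − (4n − 2)/(a(a+1))) c n / mⁿ.  For n = p − 1 the term
-- c n / mⁿ lies in p³ℤ_p: p divides the central binomial coefficient C(2p−2, p−1), and
-- each of the falling factorials a(a−1)⋯(a−p+2) and (−1−a)(−2−a)⋯(−p+1−a) has a factor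
-- divisible by p, because a ≢ −1 and a ≢ 0 leave the residue of a, resp. of −1−a, in
-- {0, …, p−2}; m, (p−1)! and a(a+1) are units.
module Submission where

open import Defs
open import Data.Nat as ℕ using (ℕ; _∸_)
open import Data.Nat.Primality using (Prime)
open import Data.Rational as ℚ using (ℚ; 0ℚ; 1ℚ; _+_; _*_; _-_; -_)
open import Data.Product using (_×_)
open import Relation.Nullary using (¬_)
open import Relation.Binary.PropositionalEquality using (_≢_)

open import Data.Integer as ℤ using (ℤ; +_)
import Data.Integer.Properties as ℤ
open import Data.Integer.DivMod using (n%ℕd<d; a≡a%ℕn+[a/ℕn]*n)
open import Data.Integer.Divisibility.Signed using (∣ᵤ⇒∣; divides)
import Data.Integer.Tactic.RingSolver as ℤ-Solver
open import Data.Nat.Base using (suc; zero; _!)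
open import Data.Nat.Combinatorics using (_C_; k![n∸k]!∣n!)
open import Data.Nat.Combinatorics.Specification using (nCk≡n!/k![n-k]!)
open import Data.Nat.Coprimality as Coprime using (Coprime; coprime-divisor; coprime-Bézout)
open import Data.Nat.DivMod using (m/n*n≡m)
open import Data.Nat.Divisibility using (_∣_; ∣-trans; ∣1⇒≡1; _∣0; m∣m*n; ∣⇒≤; m≤n⇒m!∣n!)
import Data.Nat.Divisibility as ℕ∣
open import Data.Nat.GCD using (module Bézout)
open import Data.Nat.Primality using (prime⇒nonZero; prime⇒nonTrivial; prime⇒irreducible; euclidsLemma)
import Data.Nat.Properties as ℕ
import Data.Nat.Tactic.RingSolver as ℕ-Solver
open import Data.Product using (Σ; _,_)
open import Data.Rational.Properties
  using (_≟_; +-*-commutativeRing; *-comm; *-assoc; *-distribˡ-+; *-inverseʳ; *-identityˡ; *-identityʳ;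
         *-zeroˡ; *-zeroʳ; 1≢0; toℚᵘ-injective; toℚᵘ-fromℚᵘ; toℚᵘ-homo-+; toℚᵘ-homo-*; toℚᵘ-homo‿-)
open import Data.Rational.Unnormalised as ℚᵘ using (mkℚᵘ; *≡*) renaming (_≃_ to _≃ᵘ_)
import Data.Rational.Unnormalised.Properties as ℚᵘ
open import Data.Sum using (inj₁; inj₂; [_,_]′)
open import Function.Base using (id)
open import Relation.Binary.PropositionalEquality
  using (_≡_; refl; sym; trans; cong; cong₂; subst; subst₂; module ≡-Reasoning)
open import Relation.Nullary using (yes; no; contradiction)
open import Relation.Nullary.Decidable.Core using (dec⇒maybe; toSum)
open import Tactic.RingSolver using (solve-∀)
open import Tactic.RingSolver.Core.AlmostCommutativeRing using (AlmostCommutativeRing; fromCommutativeRing)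

-- A genuine zero test lets the solver drop monomials whose coefficients cancel.
ℚ-ring : AlmostCommutativeRing _ _
ℚ-ring = fromCommutativeRing +-*-commutativeRing (λ x → dec⇒maybe (0ℚ ≟ x))

-- The ring solver cannot use hypotheses: an identity that holds modulo a relation u = v
-- is checked as a polynomial identity with an explicit cofactor k.
≡-modulo : ∀ {x y u v} k → u ≡ v → x ≡ y + k * (u - v) → x ≡ y
≡-modulo {y = y} {u = u} k refl x≡y+k[u-u] = trans x≡y+k[u-u] (vanish y k u)
  where
  vanish : ∀ y k u → y + k * (u - u) ≡ y
  vanish = solve-∀ ℚ-ring

*-inv : ∀ x → x ≢ 0ℚ → x * inv x ≡ 1ℚ
*-inv x x≢0 with x ≟ 0ℚ
... | yes x≡0 = contradiction x≡0 x≢0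
... | no x≢0′ = *-inverseʳ x {{ℚ.≢-nonZero x≢0′}}

inv-unique : ∀ x y → x * y ≡ 1ℚ → inv x ≡ y
inv-unique x y xy≡1 = begin
  inv x              ≡⟨ *-identityʳ (inv x) ⟨
  inv x * 1ℚ         ≡⟨ cong (inv x *_) xy≡1 ⟨
  inv x * (x * y)    ≡⟨ regroup (inv x) x y ⟩
  x * inv x * y      ≡⟨ cong (_* y) (*-inv x x≢0) ⟩
  1ℚ * y             ≡⟨ *-identityˡ y ⟩
  y                  ∎
  where
  open ≡-Reasoning
  regroup : ∀ i x y → i * (x * y) ≡ x * i * y
  regroup = solve-∀ ℚ-ring
  x≢0 : x ≢ 0ℚ
  x≢0 refl = 1≢0 (trans (sym xy≡1) (*-zeroˡ y))

inv-* : ∀ x y → inv (x * y) ≡ inv x * inv y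
inv-* x y with toSum (x ≟ 0ℚ) | toSum (y ≟ 0ℚ)
... | inj₁ refl | _ = trans (cong inv (*-zeroˡ y)) (sym (*-zeroˡ (inv y)))
... | inj₂ _ | inj₁ refl = trans (cong inv (*-zeroʳ x)) (sym (*-zeroʳ (inv x)))
... | inj₂ x≢0 | inj₂ y≢0 = inv-unique (x * y) (inv x * inv y) (begin
  x * y * (inv x * inv y)      ≡⟨ regroup x y (inv x) (inv y) ⟩
  (x * inv x) * (y * inv y)    ≡⟨ cong₂ _*_ (*-inv x x≢0) (*-inv y y≢0) ⟩
  1ℚ                           ∎)
  where
  open ≡-Reasoning
  regroup : ∀ x y i j → x * y * (i * j) ≡ (x * i) * (y * j)
  regroup = solve-∀ ℚ-ring

inv-^ : ∀ x n → inv (x ^ n) ≡ inv x ^ n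
inv-^ x zero = refl
inv-^ x (suc n) = trans (inv-* x (x ^ n)) (cong (inv x *_) (inv-^ x n))

÷-cancelʳ : ∀ x y z → y ≢ 0ℚ → (x * y) ÷ (z * y) ≡ x ÷ z
÷-cancelʳ x y z y≢0 = begin
  x * y * inv (z * y)        ≡⟨ cong (x * y *_) (inv-* z y) ⟩
  x * y * (inv z * inv y)    ≡⟨ regroup x y (inv z) (inv y) ⟩
  x * inv z * (y * inv y)    ≡⟨ cong (x * inv z *_) (*-inv y y≢0) ⟩
  x * inv z * 1ℚ             ≡⟨ *-identityʳ (x * inv z) ⟩
  x * inv z                  ∎
  where
  open ≡-Reasoning
  regroup : ∀ x y i j → x * y * (i * j) ≡ x * i * (y * j)
  regroup = solve-∀ ℚ-ring

÷-*-cancel : ∀ x y z → y ≢ 0ℚ → x ÷ (z * y) * y ≡ x ÷ z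
÷-*-cancel x y z y≢0 = trans (regroup x (inv (z * y)) y) (÷-cancelʳ x y z y≢0)
  where
  regroup : ∀ x i y → x * i * y ≡ x * y * i
  regroup = solve-∀ ℚ-ring

^-+ : ∀ x m n → x ^ (m ℕ.+ n) ≡ x ^ m * x ^ n
^-+ x zero n = sym (*-identityˡ (x ^ n))
^-+ x (suc m) n = trans (cong (x *_) (^-+ x m n)) (assoc x (x ^ m) (x ^ n))
  where
  assoc : ∀ x y z → x * (y * z) ≡ x * y * z
  assoc = solve-∀ ℚ-ring

fromℤ : ℤ → ℚ
fromℤ i = i ℚ./ 1

toℚᵘ-fromℤ : ∀ i → ℚ.toℚᵘ (fromℤ i) ≃ᵘ mkℚᵘ i 0
toℚᵘ-fromℤ i = toℚᵘ-fromℚᵘ (mkℚᵘ i 0)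

fromℤ-+ : ∀ i j → fromℤ (i ℤ.+ j) ≡ fromℤ i + fromℤ j
fromℤ-+ i j = toℚᵘ-injective (ℚᵘ.≃-trans (toℚᵘ-fromℤ (i ℤ.+ j)) (ℚᵘ.≃-sym
  (ℚᵘ.≃-trans (toℚᵘ-homo-+ (fromℤ i) (fromℤ j))
  (ℚᵘ.≃-trans (ℚᵘ.+-cong (toℚᵘ-fromℤ i) (toℚᵘ-fromℤ j)) (*≡* (cross i j))))))
  where
  cross : ∀ i j → (i ℤ.* + 1 ℤ.+ j ℤ.* + 1) ℤ.* + 1 ≡ (i ℤ.+ j) ℤ.* + 1
  cross = ℤ-Solver.solve-∀

fromℤ-* : ∀ i j → fromℤ (i ℤ.* j) ≡ fromℤ i * fromℤ j
fromℤ-* i j = toℚᵘ-injective (ℚᵘ.≃-trans (toℚᵘ-fromℤ (i ℤ.* j)) (ℚᵘ.≃-sym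
  (ℚᵘ.≃-trans (toℚᵘ-homo-* (fromℤ i) (fromℤ j))
  (ℚᵘ.≃-trans (ℚᵘ.*-cong (toℚᵘ-fromℤ i) (toℚᵘ-fromℤ j)) (*≡* refl)))))

fromℤ-neg : ∀ i → fromℤ (ℤ.- i) ≡ - fromℤ i
fromℤ-neg i = toℚᵘ-injective (ℚᵘ.≃-trans (toℚᵘ-fromℤ (ℤ.- i)) (ℚᵘ.≃-sym
  (ℚᵘ.≃-trans (toℚᵘ-homo‿- (fromℤ i)) (ℚᵘ.≃-trans (ℚᵘ.-‿cong (toℚᵘ-fromℤ i)) (*≡* refl)))))

ι-+ : ∀ m n → ι (m ℕ.+ n) ≡ ι m + ι n
ι-+ m n = fromℤ-+ (+ m) (+ n)

ι-* : ∀ m n → ι (m ℕ.* n) ≡ ι m * ι n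
ι-* m n = trans (cong fromℤ (ℤ.pos-* m n)) (fromℤ-* (+ m) (+ n))

ι-suc : ∀ n → ι (suc n) ≡ ι n + 1ℚ
ι-suc n = trans (ι-+ 1 n) (ℚ-comm 1ℚ (ι n))
  where
  ℚ-comm : ∀ x y → x + y ≡ y + x
  ℚ-comm = solve-∀ ℚ-ring

fromℤ-injective : ∀ {i j} → fromℤ i ≡ fromℤ j → i ≡ j
fromℤ-injective {i} {j} eq with ℚᵘ.≃-trans (ℚᵘ.≃-sym (toℚᵘ-fromℤ i))
                                   (ℚᵘ.≃-trans (ℚᵘ.≃-reflexive (cong ℚ.toℚᵘ eq)) (toℚᵘ-fromℤ j))
... | *≡* i*1≡j*1 = trans (sym (ℤ.*-identityʳ i)) (trans i*1≡j*1 (ℤ.*-identityʳ j))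

ι-≢0 : ∀ {n} → n ≢ 0 → ι n ≢ 0ℚ
ι-≢0 n≢0 ιn≡0 = n≢0 (ℤ.+-injective (fromℤ-injective ιn≡0))

clear-denominator : ∀ x → x * ι (ℚ.denominatorℕ x) ≡ fromℤ (ℚ.numerator x)
clear-denominator x@(ℚ.mkℚ n d-1 _) = toℚᵘ-injective (ℚᵘ.≃-trans
  (toℚᵘ-homo-* x (ι (suc d-1)))
  (ℚᵘ.≃-trans (ℚᵘ.*-cong (ℚᵘ.≃-refl {mkℚᵘ n d-1}) (toℚᵘ-fromℤ (+ suc d-1)))
  (ℚᵘ.≃-trans (*≡* (cross n (+ suc d-1))) (ℚᵘ.≃-sym (toℚᵘ-fromℤ n)))))
  where
  cross : ∀ n d → n ℤ.* d ℤ.* + 1 ≡ n ℤ.* (d ℤ.* + 1)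
  cross = ℤ-Solver.solve-∀

cross-multiply : ∀ x U V → x * fromℤ V ≡ fromℤ U →
                 ℚ.numerator x ℤ.* V ≡ U ℤ.* ℚ.denominator x
cross-multiply x@(ℚ.mkℚ n d-1 _) U V eq with ℚᵘ.≃-trans
  (ℚᵘ.≃-sym (ℚᵘ.≃-trans (toℚᵘ-homo-* x (fromℤ V))
                         (ℚᵘ.*-cong (ℚᵘ.≃-refl {mkℚᵘ n d-1}) (toℚᵘ-fromℤ V))))
  (ℚᵘ.≃-trans (ℚᵘ.≃-reflexive (cong ℚ.toℚᵘ eq)) (toℚᵘ-fromℤ U))
... | *≡* eq′ = trans (sym (ℤ.*-identityʳ (n ℤ.* V)))
                    (trans eq′ (cong (λ d → U ℤ.* + d) (ℕ.*-identityʳ (suc d-1))))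

n∣n! : ∀ n .{{_ : ℕ.NonZero n}} → n ∣ n !
n∣n! (suc n) = m∣m*n (n !)

central-binomial : ∀ n → ((2 ℕ.* n) C n) ℕ.* (n ! ℕ.* n !) ≡ (2 ℕ.* n) !
central-binomial n = begin
  ((2 ℕ.* n) C n) ℕ.* (n ! ℕ.* n !)             ≡⟨ cong (λ k → ((2 ℕ.* n) C n) ℕ.* (n ! ℕ.* k !)) 2n∸n≡n ⟨
  ((2 ℕ.* n) C n) ℕ.* (n ! ℕ.* (2 ℕ.* n ∸ n) !)  ≡⟨ cong (ℕ._* (n ! ℕ.* (2 ℕ.* n ∸ n) !)) (nCk≡n!/k![n-k]! n≤2n) ⟩
  (2 ℕ.* n) ! ℕ./ (n ! ℕ.* (2 ℕ.* n ∸ n) !) ℕ.* (n ! ℕ.* (2 ℕ.* n ∸ n) !)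
                                              ≡⟨ m/n*n≡m (k![n∸k]!∣n! n≤2n) ⟩
  (2 ℕ.* n) !                                 ∎
  where
  open ≡-Reasoning
  instance _ = ℕ._!*_!≢0 n (2 ℕ.* n ∸ n)
  n≤2n : n ℕ.≤ 2 ℕ.* n
  n≤2n = ℕ.m≤m+n n (n ℕ.+ 0)
  2n∸n≡n : 2 ℕ.* n ∸ n ≡ n
  2n∸n≡n = trans (ℕ.m+n∸m≡n n (n ℕ.+ 0)) (ℕ.+-identityʳ n)

central-binomial-suc : ∀ n → suc n ℕ.* ((2 ℕ.* suc n) C suc n) ≡ 2 ℕ.* suc (2 ℕ.* n) ℕ.* ((2 ℕ.* n) C n)
central-binomial-suc n = ℕ.*-cancelʳ-≡ _ _ (suc n ℕ.* (n ! ℕ.* n !)) (begin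
  suc n ℕ.* Cₙ₊₁ ℕ.* (suc n ℕ.* (n ! ℕ.* n !))
    ≡⟨ regroup (suc n) Cₙ₊₁ (n !) ⟩
  Cₙ₊₁ ℕ.* (suc n ! ℕ.* suc n !)
    ≡⟨ central-binomial (suc n) ⟩
  (2 ℕ.* suc n) !
    ≡⟨ cong _! (ℕ.*-suc 2 n) ⟩
  (2 ℕ.+ 2 ℕ.* n) ℕ.* ((1 ℕ.+ 2 ℕ.* n) ℕ.* (2 ℕ.* n) !)
    ≡⟨ cong (λ k → (2 ℕ.+ 2 ℕ.* n) ℕ.* ((1 ℕ.+ 2 ℕ.* n) ℕ.* k)) (central-binomial n) ⟨
  (2 ℕ.+ 2 ℕ.* n) ℕ.* ((1 ℕ.+ 2 ℕ.* n) ℕ.* (Cₙ ℕ.* (n ! ℕ.* n !)))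
    ≡⟨ regroup′ n Cₙ (n ! ℕ.* n !) ⟩
  2 ℕ.* suc (2 ℕ.* n) ℕ.* Cₙ ℕ.* (suc n ℕ.* (n ! ℕ.* n !)) ∎)
  where
  open ≡-Reasoning
  instance _ = ℕ.m*n≢0 (suc n) (n ! ℕ.* n !) {{_}} {{ℕ._!*_!≢0 n n}}
  Cₙ Cₙ₊₁ : ℕ
  Cₙ = (2 ℕ.* n) C n
  Cₙ₊₁ = (2 ℕ.* suc n) C suc n
  regroup : ∀ s c f → s ℕ.* c ℕ.* (s ℕ.* (f ℕ.* f)) ≡ c ℕ.* (s ℕ.* f ℕ.* (s ℕ.* f))
  regroup = ℕ-Solver.solve-∀
  regroup′ : ∀ n c f → (2 ℕ.+ 2 ℕ.* n) ℕ.* ((1 ℕ.+ 2 ℕ.* n) ℕ.* (c ℕ.* f))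
                       ≡ 2 ℕ.* (1 ℕ.+ 2 ℕ.* n) ℕ.* c ℕ.* ((1 ℕ.+ n) ℕ.* f)
  regroup′ = ℕ-Solver.solve-∀

-- The recurrence of c and the telescoping identities

*-≢0 : ∀ x y → x ≢ 0ℚ → y ≢ 0ℚ → x * y ≢ 0ℚ
*-≢0 x y x≢0 y≢0 xy≡0 = 1≢0 (begin
  1ℚ                          ≡⟨ cong₂ _*_ (*-inv x x≢0) (*-inv y y≢0) ⟨
  (x * inv x) * (y * inv y)   ≡⟨ regroup x y (inv x) (inv y) ⟩
  x * y * (inv x * inv y)     ≡⟨ cong (_* (inv x * inv y)) xy≡0 ⟩
  0ℚ * (inv x * inv y)        ≡⟨ *-zeroˡ (inv x * inv y) ⟩
  0ℚ                          ∎)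
  where
  open ≡-Reasoning
  regroup : ∀ x y i j → (x * i) * (y * j) ≡ x * y * (i * j)
  regroup = solve-∀ ℚ-ring

^-≢0 : ∀ x n → x ≢ 0ℚ → x ^ n ≢ 0ℚ
^-≢0 x zero x≢0 = 1≢0
^-≢0 x (suc n) x≢0 = *-≢0 x (x ^ n) x≢0 (^-≢0 x n x≢0)

÷-^-suc : ∀ x z y k → y ≢ 0ℚ → x ÷ (z * y ^ suc k) * y ≡ x ÷ (z * y ^ k)
÷-^-suc x z y k y≢0 = trans (cong (λ u → x ÷ u * y) (regroup z y (y ^ k))) (÷-*-cancel x y (z * y ^ k) y≢0)
  where
  regroup : ∀ z y r → z * (y * r) ≡ z * r * y
  regroup = solve-∀ ℚ-ring

binom-suc : ∀ x n → binom x (suc n) ≡ binom x n * (x - ι n) * inv (ι (suc n))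
binom-suc x n = begin
  falling x n * (x - ι n) * inv (ι (suc n ℕ.* n !))         ≡⟨ cong (falling x n * (x - ι n) *_) inv-ι-suc! ⟩
  falling x n * (x - ι n) * (inv (ι (suc n)) * inv (ι (n !)))  ≡⟨ regroup (falling x n) (x - ι n) (inv (ι (suc n))) (inv (ι (n !))) ⟩
  falling x n * inv (ι (n !)) * (x - ι n) * inv (ι (suc n))    ∎
  where
  open ≡-Reasoning
  inv-ι-suc! : inv (ι (suc n ℕ.* n !)) ≡ inv (ι (suc n)) * inv (ι (n !))
  inv-ι-suc! = trans (cong inv (ι-* (suc n) (n !))) (inv-* (ι (suc n)) (ι (n !)))
  regroup : ∀ f y u g → f * y * (u * g) ≡ f * g * y * u
  regroup = solve-∀ ℚ-ring

c-ratio : ℚ → ℚ → ℚ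
c-ratio a n = (a - n) * (- 1ℚ - a - n) * (ι 2 * (ι 2 * n + 1ℚ))

c-suc : ∀ a n → c a (suc n) * ι (suc n) ^ 3 ≡ c-ratio a (ι n) * c a n
c-suc a n = begin
  binom a (suc n) * binom b (suc n) * ι Cₙ₊₁ * q ^ 3
      ≡⟨ cong₂ (λ s t → s * t * ι Cₙ₊₁ * q ^ 3) (binom-suc a n) (binom-suc b n) ⟩
  binom a n * (a - ι n) * u * (binom b n * (b - ι n) * u) * ι Cₙ₊₁ * q ^ 3
      ≡⟨ regroup (binom a n) (binom b n) (a - ι n) (b - ι n) u q (ι Cₙ₊₁) ⟩
  binom a n * binom b n * ((a - ι n) * (b - ι n)) * ((q * u) * (q * u)) * (q * ι Cₙ₊₁)
      ≡⟨ cong₂ (λ s t → binom a n * binom b n * ((a - ι n) * (b - ι n)) * (s * s) * t)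
               (*-inv q (ι-≢0 {suc n} λ ())) ι-central-binomial-suc ⟩
  binom a n * binom b n * ((a - ι n) * (b - ι n)) * (1ℚ * 1ℚ) * (ι 2 * (ι 2 * ι n + 1ℚ) * ι Cₙ)
      ≡⟨ regroup′ (binom a n) (binom b n) (a - ι n) (b - ι n) (ι 2 * (ι 2 * ι n + 1ℚ)) (ι Cₙ) ⟩
  c-ratio a (ι n) * c a n ∎
  where
  open ≡-Reasoning
  b q u : ℚ
  b = - 1ℚ - a
  q = ι (suc n)
  u = inv q
  Cₙ Cₙ₊₁ : ℕ
  Cₙ = (2 ℕ.* n) C n
  Cₙ₊₁ = (2 ℕ.* suc n) C suc n
  ι-central-binomial-suc : q * ι Cₙ₊₁ ≡ ι 2 * (ι 2 * ι n + 1ℚ) * ι Cₙ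
  ι-central-binomial-suc = begin
    q * ι Cₙ₊₁                            ≡⟨ ι-* (suc n) Cₙ₊₁ ⟨
    ι (suc n ℕ.* Cₙ₊₁)                    ≡⟨ cong ι (central-binomial-suc n) ⟩
    ι (2 ℕ.* suc (2 ℕ.* n) ℕ.* Cₙ)        ≡⟨ ι-* (2 ℕ.* suc (2 ℕ.* n)) Cₙ ⟩
    ι (2 ℕ.* suc (2 ℕ.* n)) * ι Cₙ        ≡⟨ cong (_* ι Cₙ) (ι-* 2 (suc (2 ℕ.* n))) ⟩
    ι 2 * ι (suc (2 ℕ.* n)) * ι Cₙ
      ≡⟨ cong (λ v → ι 2 * v * ι Cₙ) (trans (ι-suc (2 ℕ.* n)) (cong (_+ 1ℚ) (ι-* 2 n))) ⟩
    ι 2 * (ι 2 * ι n + 1ℚ) * ι Cₙ         ∎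
  regroup : ∀ A B x y u q C → A * x * u * (B * y * u) * C * (q * (q * (q * 1ℚ)))
                              ≡ A * B * (x * y) * ((q * u) * (q * u)) * (q * C)
  regroup = solve-∀ ℚ-ring
  regroup′ : ∀ A B x y k C → A * B * (x * y) * (1ℚ * 1ℚ) * (k * C) ≡ x * y * k * (A * B * C)
  regroup′ = solve-∀ ℚ-ring

form₁ : ℚ → ℚ → ℚ → ℚ → ℚ → ℚ → ℚ
form₁ a m S₂ Sₖ S₀ S₁ =
  ι 2 * a * (a + 1ℚ) * S₂ - ((m - ι 4) * Sₖ + ι 2 * S₀ + (ι 4 * a * (a + 1ℚ) - ι 2) * S₁)

form₂ : ℚ → ℚ → ℚ → ℚ → ℚ → ℚ → ℚ → ℚ
form₂ a i m S₃ Sₖ S₀ S₁ =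
  ι 2 * a * (a + 1ℚ) * S₃
  - (- m + (ι 2 * m - ι 8 - (m - ι 4) * i) * Sₖ + (m - ι 2 * i) * S₀ + (ι 8 * a * (a + 1ℚ) - ι 2 + ι 2 * i) * S₁)

module Sums (a m : ℚ) where

  τ₀ τ₁ τ₂ τ₃ τₖ σ₀ σ₁ σ₂ σ₃ σₖ : ℕ → ℚ
  τ₀ k = c a k ÷ m ^ k
  τ₁ k = c a k ÷ (m ^ k * ι (suc k))
  τ₂ k = c a k ÷ (m ^ k * (ι (suc k) ^ 2))
  τ₃ k = c a k ÷ (m ^ k * (ι (suc k) ^ 3))
  τₖ k = ι k * c a k ÷ m ^ k
  σ₀ n = sumTo n τ₀
  σ₁ n = sumTo n τ₁
  σ₂ n = sumTo n τ₂
  σ₃ n = sumTo n τ₃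
  σₖ n = sumTo n τₖ

  -- defectᵢ n is the left minus the right side of the i-th congruence for p = n + 1
  defect₁ defect₂ : ℕ → ℚ
  defect₁ n = form₁ a m (σ₂ n) (σₖ (suc n)) (σ₀ (suc n)) (σ₁ n)
  defect₂ n = form₂ a (inv (a * (a + 1ℚ))) m (σ₃ n) (σₖ (suc n)) (σ₀ (suc n)) (σ₁ n)

  module _ (n : ℕ) where

    private
      q : ℚ
      q = ι (suc n)
      q≢0 : q ≢ 0ℚ
      q≢0 = ι-≢0 {suc n} λ ()

    τ₂≡τ₃q : τ₂ n ≡ τ₃ n * q
    τ₂≡τ₃q = sym (÷-^-suc (c a n) (m ^ n) q 2 q≢0)

    τ₁≡τ₂q : τ₁ n ≡ τ₂ n * q
    τ₁≡τ₂q = sym (trans (÷-^-suc (c a n) (m ^ n) q 1 q≢0) (cong (λ u → c a n ÷ (m ^ n * u)) (*-identityʳ q)))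

    τ₀≡τ₁q : τ₀ n ≡ τ₁ n * q
    τ₀≡τ₁q = sym (÷-*-cancel (c a n) q (m ^ n) q≢0)

    m*τ₀-suc : m ≢ 0ℚ → m * τ₀ (suc n) ≡ c-ratio a (ι n) * τ₃ n
    m*τ₀-suc m≢0 = begin
      m * (c′ * inv (m * m ^ n))                ≡⟨ regroup c′ m (inv (m * m ^ n)) ⟩
      c′ * m * inv (m * m ^ n)                  ≡⟨ cong (λ u → c′ * m * inv u) (*-comm m (m ^ n)) ⟩
      (c′ * m) ÷ (m ^ n * m)                    ≡⟨ ÷-cancelʳ c′ m (m ^ n) m≢0 ⟩
      c′ ÷ m ^ n                                ≡⟨ ÷-cancelʳ c′ (q ^ 3) (m ^ n) (^-≢0 q 3 q≢0) ⟨
      (c′ * q ^ 3) ÷ (m ^ n * q ^ 3)            ≡⟨ cong (_÷ (m ^ n * q ^ 3)) (c-suc a n) ⟩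
      (c-ratio a (ι n) * c a n) ÷ (m ^ n * q ^ 3)   ≡⟨ *-assoc (c-ratio a (ι n)) (c a n) (inv (m ^ n * q ^ 3)) ⟩
      c-ratio a (ι n) * τ₃ n                    ∎
      where
      open ≡-Reasoning
      c′ : ℚ
      c′ = c a (suc n)
      regroup : ∀ c m i → m * (c * i) ≡ c * m * i
      regroup = solve-∀ ℚ-ring

form₁-step : ∀ a m n {q t₂ t₁ t₀} S₂ Sₖ S₀ S₁ t₃ c′ w →
  q ≡ n + 1ℚ → t₂ ≡ t₃ * q → t₁ ≡ t₂ * q → t₀ ≡ t₁ * q → m * (c′ * w) ≡ c-ratio a n * t₃ →
  form₁ a m (S₂ + t₂) (Sₖ + q * c′ * w) (S₀ + c′ * w) (S₁ + t₁) - form₁ a m S₂ Sₖ S₀ S₁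
    ≡ (ι 4 * q - ι 2) * (c′ * w) - (ι 4 * n - ι 2) * t₀
form₁-step a m n S₂ Sₖ S₀ S₁ t₃ c′ w refl refl refl refl mT′≡Kt₃ =
  ≡-modulo (- (n + 1ℚ)) mT′≡Kt₃ (identity a m n S₂ Sₖ S₀ S₁ t₃ c′ w)
  where
  identity : ∀ a m n S₂ Sₖ S₀ S₁ t c w →
    (ι 2 * a * (a + 1ℚ) * (S₂ + t * (n + 1ℚ))
      - ((m - ι 4) * (Sₖ + (n + 1ℚ) * c * w) + ι 2 * (S₀ + c * w)
         + (ι 4 * a * (a + 1ℚ) - ι 2) * (S₁ + t * (n + 1ℚ) * (n + 1ℚ))))
    - (ι 2 * a * (a + 1ℚ) * S₂ - ((m - ι 4) * Sₖ + ι 2 * S₀ + (ι 4 * a * (a + 1ℚ) - ι 2) * S₁))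
    ≡ (ι 4 * (n + 1ℚ) - ι 2) * (c * w) - (ι 4 * n - ι 2) * (t * (n + 1ℚ) * (n + 1ℚ) * (n + 1ℚ))
      + (- (n + 1ℚ)) * (m * (c * w) - (a - n) * (- 1ℚ - a - n) * (ι 2 * (ι 2 * n + 1ℚ)) * t)
  identity = solve-∀ ℚ-ring

form₂-step : ∀ a i m n {q t₁ t₀} S₃ Sₖ S₀ S₁ t₃ c′ w →
  q ≡ n + 1ℚ → t₁ ≡ t₃ * q * q → t₀ ≡ t₁ * q →
  i * (a * (a + 1ℚ)) ≡ 1ℚ → m * (c′ * w) ≡ c-ratio a n * t₃ →
  form₂ a i m (S₃ + t₃) (Sₖ + q * c′ * w) (S₀ + c′ * w) (S₁ + t₁) - form₂ a i m S₃ Sₖ S₀ S₁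
    ≡ (ι 8 * q - (ι 4 * q - ι 2) * i) * (c′ * w) - (ι 8 * n - (ι 4 * n - ι 2) * i) * t₀
form₂-step a i m n S₃ Sₖ S₀ S₁ t₃ c′ w refl refl refl iA≡1 mT′≡Kt₃ =
  ≡-modulo (- (ι 2 * (ι 2 * n + 1ℚ) * (n + 1ℚ) * t₃)) iA≡1
    (≡-modulo (- (ι 2 * (n + 1ℚ) + 1ℚ - i * (n + 1ℚ))) mT′≡Kt₃ (identity a i m n S₃ Sₖ S₀ S₁ t₃ c′ w))
  where
  identity : ∀ a i m n S₃ Sₖ S₀ S₁ t c w →
    (ι 2 * a * (a + 1ℚ) * (S₃ + t)
      - (- m + (ι 2 * m - ι 8 - (m - ι 4) * i) * (Sₖ + (n + 1ℚ) * c * w) + (m - ι 2 * i) * (S₀ + c * w)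
         + (ι 8 * a * (a + 1ℚ) - ι 2 + ι 2 * i) * (S₁ + t * (n + 1ℚ) * (n + 1ℚ))))
    - (ι 2 * a * (a + 1ℚ) * S₃
      - (- m + (ι 2 * m - ι 8 - (m - ι 4) * i) * Sₖ + (m - ι 2 * i) * S₀ + (ι 8 * a * (a + 1ℚ) - ι 2 + ι 2 * i) * S₁))
    ≡ (ι 8 * (n + 1ℚ) - (ι 4 * (n + 1ℚ) - ι 2) * i) * (c * w)
      - (ι 8 * n - (ι 4 * n - ι 2) * i) * (t * (n + 1ℚ) * (n + 1ℚ) * (n + 1ℚ))
      + (- (ι 2 * (ι 2 * n + 1ℚ) * (n + 1ℚ) * t)) * (i * (a * (a + 1ℚ)) - 1ℚ)
      + (- (ι 2 * (n + 1ℚ) + 1ℚ - i * (n + 1ℚ))) * (m * (c * w) - (a - n) * (- 1ℚ - a - n) * (ι 2 * (ι 2 * n + 1ℚ)) * t)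
  identity = solve-∀ ℚ-ring

telescope : ∀ (D E : ℕ → ℚ) → D 0 ≡ E 0 → (∀ n → D (suc n) - D n ≡ E (suc n) - E n) → ∀ n → D n ≡ E n
telescope D E base step zero = base
telescope D E base step (suc n) = begin
  D (suc n)                         ≡⟨ split (D (suc n)) (D n) ⟩
  D (suc n) - D n + D n             ≡⟨ cong₂ _+_ (step n) (telescope D E base step n) ⟩
  E (suc n) - E n + E n             ≡⟨ split (E (suc n)) (E n) ⟨
  E (suc n)                         ∎
  where
  open ≡-Reasoning
  split : ∀ x y → x ≡ x - y + y
  split = solve-∀ ℚ-ring

module _ (a m : ℚ) (m≢0 : m ≢ 0ℚ) where

  open Sums a m

  defect₁-closed : ∀ n → defect₁ n ≡ (ι 4 * ι n - ι 2) * τ₀ n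
  defect₁-closed = telescope defect₁ (λ n → (ι 4 * ι n - ι 2) * τ₀ n) (base a m) step
    where
    base : ∀ a m → ι 2 * a * (a + 1ℚ) * 0ℚ
                   - ((m - ι 4) * (0ℚ + ι 0 * 1ℚ) + ι 2 * (0ℚ + 1ℚ) + (ι 4 * a * (a + 1ℚ) - ι 2) * 0ℚ)
                 ≡ (ι 4 * ι 0 - ι 2) * 1ℚ
    base = solve-∀ ℚ-ring
    step : ∀ n → defect₁ (suc n) - defect₁ n ≡ (ι 4 * ι (suc n) - ι 2) * τ₀ (suc n) - (ι 4 * ι n - ι 2) * τ₀ n
    step n = form₁-step a m (ι n) (σ₂ n) (σₖ (suc n)) (σ₀ (suc n)) (σ₁ n) (τ₃ n) (c a (suc n)) (inv (m ^ suc n))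
      (ι-suc n) (τ₂≡τ₃q n) (τ₁≡τ₂q n) (τ₀≡τ₁q n) (m*τ₀-suc n m≢0)

  defect₂-closed : a * (a + 1ℚ) ≢ 0ℚ →
                   ∀ n → defect₂ n ≡ (ι 8 * ι n - (ι 4 * ι n - ι 2) * inv (a * (a + 1ℚ))) * τ₀ n
  defect₂-closed A≢0 = telescope defect₂ (λ n → (ι 8 * ι n - (ι 4 * ι n - ι 2) * i) * τ₀ n) (base a i m) step
    where
    i : ℚ
    i = inv (a * (a + 1ℚ))
    iA≡1 : i * (a * (a + 1ℚ)) ≡ 1ℚ
    iA≡1 = trans (*-comm i (a * (a + 1ℚ))) (*-inv (a * (a + 1ℚ)) A≢0)
    base : ∀ a i m → ι 2 * a * (a + 1ℚ) * 0ℚ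
                     - (- m + (ι 2 * m - ι 8 - (m - ι 4) * i) * (0ℚ + ι 0 * 1ℚ) + (m - ι 2 * i) * (0ℚ + 1ℚ)
                        + (ι 8 * a * (a + 1ℚ) - ι 2 + ι 2 * i) * 0ℚ)
                   ≡ (ι 8 * ι 0 - (ι 4 * ι 0 - ι 2) * i) * 1ℚ
    base = solve-∀ ℚ-ring
    step : ∀ n → defect₂ (suc n) - defect₂ n
               ≡ (ι 8 * ι (suc n) - (ι 4 * ι (suc n) - ι 2) * i) * τ₀ (suc n)
                 - (ι 8 * ι n - (ι 4 * ι n - ι 2) * i) * τ₀ n
    step n = form₂-step a i m (ι n) (σ₃ n) (σₖ (suc n)) (σ₀ (suc n)) (σ₁ n) (τ₃ n) (c a (suc n)) (inv (m ^ suc n))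
      (ι-suc n) (trans (τ₁≡τ₂q n) (cong (_* ι (suc n)) (τ₂≡τ₃q n))) (τ₀≡τ₁q n) iA≡1 (m*τ₀-suc n m≢0)

-- p-adic integers and the divisibility of c (p − 1)

-- x ∈ pⁿℤ_p; note that Cong p n x y unfolds to Multiple p n (x - y)
Multiple : ℕ → ℕ → ℚ → Set
Multiple p n x = Σ ℚ λ z → InZp p z × x ≡ ι p ^ n * z

module Padic {p : ℕ} (p-prime : Prime p) where

  instance
    p≢0 : ℕ.NonZero p
    p≢0 = prime⇒nonZero p-prime

  p∤1 : ¬ p ∣ 1
  p∤1 p∣1 = ℕ.nonTrivial⇒≢1 {{prime⇒nonTrivial p-prime}} (∣1⇒≡1 p∣1)

  p∤* : ∀ {m n} → ¬ p ∣ m → ¬ p ∣ n → ¬ p ∣ m ℕ.* n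
  p∤* {m} {n} p∤m p∤n p∣mn = [ p∤m , p∤n ]′ (euclidsLemma m n p-prime p∣mn)

  InZp-by-clearing : ∀ x U V → x * fromℤ V ≡ fromℤ U → ¬ p ∣ ℤ.∣ V ∣ → InZp p x
  InZp-by-clearing x@(ℚ.mkℚ n d-1 coprime) U V eq p∤V p∣d = p∤V (∣-trans p∣d d∣V)
    where
    d∣V : suc d-1 ∣ ℤ.∣ V ∣
    d∣V = coprime-divisor (Coprime.sym (Coprime.recompute coprime)) (ℕ∣.divides ℤ.∣ U ∣ (begin
      ℤ.∣ n ∣ ℕ.* ℤ.∣ V ∣       ≡⟨ ℤ.abs-* n V ⟨
      ℤ.∣ n ℤ.* V ∣             ≡⟨ cong ℤ.∣_∣ (cross-multiply x U V eq) ⟩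
      ℤ.∣ U ℤ.* + suc d-1 ∣     ≡⟨ ℤ.abs-* U (+ suc d-1) ⟩
      ℤ.∣ U ∣ ℕ.* suc d-1       ∎))
      where open ≡-Reasoning

  InZp-by-clearingℕ : ∀ x U d → x * ι d ≡ fromℤ U → ¬ p ∣ d → InZp p x
  InZp-by-clearingℕ x U d eq = InZp-by-clearing x U (+ d) eq

  InZp-fromℤ : ∀ i → InZp p (fromℤ i)
  InZp-fromℤ i = InZp-by-clearingℕ (fromℤ i) i 1 (*-identityʳ (fromℤ i)) p∤1

  InZp-ι : ∀ n → InZp p (ι n)
  InZp-ι n = InZp-fromℤ (+ n)

  module _ (x y : ℚ) (x∈ : InZp p x) (y∈ : InZp p y) where

    private
      dx dy : ℕ
      dx = ℚ.denominatorℕ x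
      dy = ℚ.denominatorℕ y
      nx ny : ℤ
      nx = ℚ.numerator x
      ny = ℚ.numerator y
      p∤dxdy : ¬ p ∣ dx ℕ.* dy
      p∤dxdy = p∤* x∈ y∈
      open ≡-Reasoning

    InZp-+ : InZp p (x + y)
    InZp-+ = InZp-by-clearingℕ (x + y) (nx ℤ.* + dy ℤ.+ ny ℤ.* + dx) (dx ℕ.* dy) (begin
      (x + y) * ι (dx ℕ.* dy)               ≡⟨ cong ((x + y) *_) (ι-* dx dy) ⟩
      (x + y) * (ι dx * ι dy)               ≡⟨ expand x y (ι dx) (ι dy) ⟩
      x * ι dx * ι dy + y * ι dy * ι dx
        ≡⟨ cong₂ (λ u v → u * ι dy + v * ι dx) (clear-denominator x) (clear-denominator y) ⟩
      fromℤ nx * ι dy + fromℤ ny * ι dx     ≡⟨ cong₂ _+_ (fromℤ-* nx (+ dy)) (fromℤ-* ny (+ dx)) ⟨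
      fromℤ (nx ℤ.* + dy) + fromℤ (ny ℤ.* + dx)   ≡⟨ fromℤ-+ (nx ℤ.* + dy) (ny ℤ.* + dx) ⟨
      fromℤ (nx ℤ.* + dy ℤ.+ ny ℤ.* + dx)   ∎) p∤dxdy
      where
      expand : ∀ x y u v → (x + y) * (u * v) ≡ x * u * v + y * v * u
      expand = solve-∀ ℚ-ring

    InZp-* : InZp p (x * y)
    InZp-* = InZp-by-clearingℕ (x * y) (nx ℤ.* ny) (dx ℕ.* dy) (begin
      x * y * ι (dx ℕ.* dy)               ≡⟨ cong (x * y *_) (ι-* dx dy) ⟩
      x * y * (ι dx * ι dy)               ≡⟨ regroup x y (ι dx) (ι dy) ⟩
      x * ι dx * (y * ι dy)               ≡⟨ cong₂ _*_ (clear-denominator x) (clear-denominator y) ⟩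
      fromℤ nx * fromℤ ny                 ≡⟨ fromℤ-* nx ny ⟨
      fromℤ (nx ℤ.* ny)                   ∎) p∤dxdy
      where
      regroup : ∀ x y u v → x * y * (u * v) ≡ x * u * (y * v)
      regroup = solve-∀ ℚ-ring

  InZp-neg : ∀ x → InZp p x → InZp p (- x)
  InZp-neg x x∈ = subst (InZp p) (minus-one x) (InZp-* (- 1ℚ) x (InZp-fromℤ (ℤ.- + 1)) x∈)
    where
    minus-one : ∀ x → - 1ℚ * x ≡ - x
    minus-one = solve-∀ ℚ-ring

  InZp-- : ∀ x y → InZp p x → InZp p y → InZp p (x - y)
  InZp-- x y x∈ y∈ = InZp-+ x (- y) x∈ (InZp-neg y y∈)

  InZp-^ : ∀ x n → InZp p x → InZp p (x ^ n)
  InZp-^ x zero x∈ = InZp-ι 1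
  InZp-^ x (suc n) x∈ = InZp-* x (x ^ n) x∈ (InZp-^ x n x∈)

  InZp-falling : ∀ x n → InZp p x → InZp p (falling x n)
  InZp-falling x zero x∈ = InZp-ι 1
  InZp-falling x (suc n) x∈ =
    InZp-* (falling x n) (x - ι n) (InZp-falling x n x∈) (InZp-- x (ι n) x∈ (InZp-ι n))

  InZp-inv-ι : ∀ {n} → ¬ p ∣ n → InZp p (inv (ι n))
  InZp-inv-ι {n} p∤n = InZp-by-clearingℕ (inv (ι n)) (+ 1) n
    (trans (*-comm (inv (ι n)) (ι n)) (*-inv (ι n) (ι-≢0 n≢0))) p∤n
    where
    n≢0 : n ≢ 0
    n≢0 refl = p∤n (p ∣0)

  Multiple-≡ : ∀ n {x y} → x ≡ y → Multiple p n x → Multiple p n y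
  Multiple-≡ n x≡y = subst (Multiple p n) x≡y

  Multiple-0 : ∀ n → Multiple p n 0ℚ
  Multiple-0 n = 0ℚ , InZp-ι 0 , sym (*-zeroʳ (ι p ^ n))

  Multiple-+ : ∀ n {x y} → Multiple p n x → Multiple p n y → Multiple p n (x + y)
  Multiple-+ n {x} {y} (z , z∈ , x≡pⁿz) (w , w∈ , y≡pⁿw) =
    z + w , InZp-+ z w z∈ w∈ ,
    trans (cong₂ _+_ x≡pⁿz y≡pⁿw) (sym (*-distribˡ-+ (ι p ^ n) z w))

  Multiple-*ʳ : ∀ n {x} → Multiple p n x → ∀ u → InZp p u → Multiple p n (x * u)
  Multiple-*ʳ n (z , z∈ , x≡pⁿz) u u∈ =
    z * u , InZp-* z u z∈ u∈ , trans (cong (_* u) x≡pⁿz) (*-assoc (ι p ^ n) z u)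

  Multiple-*ˡ : ∀ n {x} u → InZp p u → Multiple p n x → Multiple p n (u * x)
  Multiple-*ˡ n {x} u u∈ x∈pⁿ = Multiple-≡ n (*-comm x u) (Multiple-*ʳ n x∈pⁿ u u∈)

  Multiple-* : ∀ m n {x y} → Multiple p m x → Multiple p n y → Multiple p (m ℕ.+ n) (x * y)
  Multiple-* m n {x} {y} (z , z∈ , x≡pᵐz) (w , w∈ , y≡pⁿw) =
    z * w , InZp-* z w z∈ w∈ , (begin
      x * y                               ≡⟨ cong₂ _*_ x≡pᵐz y≡pⁿw ⟩
      ι p ^ m * z * (ι p ^ n * w)         ≡⟨ regroup (ι p ^ m) z (ι p ^ n) w ⟩
      ι p ^ m * ι p ^ n * (z * w)         ≡⟨ cong (_* (z * w)) (^-+ (ι p) m n) ⟨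
      ι p ^ (m ℕ.+ n) * (z * w)           ∎)
    where
    open ≡-Reasoning
    regroup : ∀ P z Q w → P * z * (Q * w) ≡ P * Q * (z * w)
    regroup = solve-∀ ℚ-ring

  Multiple-ι : ∀ {k} → p ∣ k → Multiple p 1 (ι k)
  Multiple-ι {k} (ℕ∣.divides q k≡qp) =
    ι q , InZp-ι q , trans (cong ι k≡qp) (trans (ι-* q p) (regroup (ι q) (ι p)))
    where
    regroup : ∀ q P → q * P ≡ P * 1ℚ * q
    regroup = solve-∀ ℚ-ring

  ¬Cong⇒≢0 : ∀ n x → ¬ Cong p n x 0ℚ → x ≢ 0ℚ
  ¬Cong⇒≢0 n x x≢0 refl = x≢0 (Multiple-0 n)

  p∤numerator : ∀ x → InZp p x → ¬ Cong p 1 x 0ℚ → ¬ p ∣ ℤ.∣ ℚ.numerator x ∣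
  p∤numerator x x∈ x≢0 p∣n with ∣ᵤ⇒∣ {+ p} {ℚ.numerator x} p∣n
  ... | divides k n≡kp = x≢0 (fromℤ k * inv (ι d) ,
    InZp-* (fromℤ k) (inv (ι d)) (InZp-fromℤ k) (InZp-inv-ι x∈) , (begin
      x - 0ℚ                        ≡⟨ *-identityʳ (x - 0ℚ) ⟨
      (x - 0ℚ) * 1ℚ                 ≡⟨ cong ((x - 0ℚ) *_) (*-inv (ι d) (ι-≢0 {d} λ ())) ⟨
      (x - 0ℚ) * (ι d * inv (ι d))  ≡⟨ regroup x (ι d) (inv (ι d)) ⟩
      x * ι d * inv (ι d)           ≡⟨ cong (_* inv (ι d)) (clear-denominator x) ⟩
      fromℤ (ℚ.numerator x) * inv (ι d)   ≡⟨ cong (λ n → fromℤ n * inv (ι d)) n≡kp ⟩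
      fromℤ (k ℤ.* + p) * inv (ι d)       ≡⟨ cong (_* inv (ι d)) (fromℤ-* k (+ p)) ⟩
      fromℤ k * ι p * inv (ι d)     ≡⟨ regroup′ (fromℤ k) (ι p) (inv (ι d)) ⟩
      ι p * 1ℚ * (fromℤ k * inv (ι d))    ∎))
    where
    open ≡-Reasoning
    d : ℕ
    d = ℚ.denominatorℕ x
    regroup : ∀ x d i → (x - 0ℚ) * (d * i) ≡ x * d * i
    regroup = solve-∀ ℚ-ring
    regroup′ : ∀ k P i → k * P * i ≡ P * 1ℚ * (k * i)
    regroup′ = solve-∀ ℚ-ring

  InZp-inv : ∀ x → InZp p x → ¬ Cong p 1 x 0ℚ → InZp p (inv x)
  InZp-inv x x∈ x≢0 = InZp-by-clearing (inv x) (+ d) n (begin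
      inv x * fromℤ n          ≡⟨ cong (inv x *_) (clear-denominator x) ⟨
      inv x * (x * ι d)        ≡⟨ regroup (inv x) x (ι d) ⟩
      x * inv x * ι d          ≡⟨ cong (_* ι d) (*-inv x x≢0ℚ) ⟩
      1ℚ * ι d                 ≡⟨ *-identityˡ (ι d) ⟩
      ι d                      ∎) (p∤numerator x x∈ x≢0)
    where
    open ≡-Reasoning
    n : ℤ
    n = ℚ.numerator x
    d : ℕ
    d = ℚ.denominatorℕ x
    regroup : ∀ i x d → i * (x * d) ≡ x * i * d
    regroup = solve-∀ ℚ-ring
    x≢0ℚ : x ≢ 0ℚ
    x≢0ℚ = ¬Cong⇒≢0 1 x x≢0

  coprime-p : ∀ {d} → ¬ p ∣ d → Coprime p d
  coprime-p p∤d {k} (k∣p , k∣d) with prime⇒irreducible p-prime k∣p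
  ... | inj₁ k≡1 = k≡1
  ... | inj₂ refl = contradiction k∣d p∤d

  private
    lift : ∀ {a b c e} → 1 ℕ.+ a ℕ.* b ≡ c ℕ.* e → 1ℚ + ι a * ι b ≡ ι c * ι e
    lift {a} {b} {c} {e} eq = trans (sym (trans (ι-+ 1 (a ℕ.* b)) (cong (λ u → 1ℚ + u) (ι-* a b))))
                                     (trans (cong ι eq) (ι-* c e))

  inverse-mod-p : ∀ {d} → ¬ p ∣ d → Σ ℤ λ w → Σ ℤ λ t → ι d * fromℤ w ≡ 1ℚ + ι p * fromℤ t
  inverse-mod-p {d} p∤d with coprime-Bézout (Coprime.sym (coprime-p p∤d))
  ... | Bézout.+- w t 1+tp≡wd =
    + w , + t , ≡-modulo (- 1ℚ) (lift {t} {p} {w} {d} 1+tp≡wd) (rearrange (ι d) (ι w) (ι p) (ι t))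
    where
    rearrange : ∀ d w p t → d * w ≡ 1ℚ + p * t + - 1ℚ * (1ℚ + t * p - w * d)
    rearrange = solve-∀ ℚ-ring
  ... | Bézout.-+ w t 1+wd≡tp =
    ℤ.- + w , ℤ.- + t ,
    subst₂ (λ u v → ι d * u ≡ 1ℚ + ι p * v) (sym (fromℤ-neg (+ w))) (sym (fromℤ-neg (+ t)))
      (≡-modulo (- 1ℚ) (lift {w} {d} {t} {p} 1+wd≡tp) (rearrange (ι d) (ι w) (ι p) (ι t)))
    where
    rearrange : ∀ d w p t → d * - w ≡ 1ℚ + p * - t + - 1ℚ * (1ℚ + w * d - t * p)
    rearrange = solve-∀ ℚ-ring

  residue : ∀ x → InZp p x → Σ ℕ λ j → j ℕ.< p × Cong p 1 x (ι j)
  residue x x∈ with inverse-mod-p x∈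
  ... | w , t , dw≡1+pt =
    j , n%ℕd<d r p , fromℤ q - fromℤ t * x ,
    InZp-- (fromℤ q) (fromℤ t * x) (InZp-fromℤ q) (InZp-* (fromℤ t) x (InZp-fromℤ t) x∈) ,
    ≡-modulo (- x) dw≡1+pt (≡-modulo (fromℤ w) (clear-denominator x) (≡-modulo 1ℚ nw≡j+qp
      (rearrange x (ι j) (ι (ℚ.denominatorℕ x)) (fromℤ w) (ι p) (fromℤ t) (fromℤ q) (fromℤ n))))
    where
    n r q : ℤ
    n = ℚ.numerator x
    r = n ℤ.* w
    q = r ℤ./ℕ p
    j : ℕ
    j = r ℤ.%ℕ p
    nw≡j+qp : fromℤ n * fromℤ w ≡ ι j + fromℤ q * ι p
    nw≡j+qp = begin
      fromℤ n * fromℤ w            ≡⟨ fromℤ-* n w ⟨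
      fromℤ r                      ≡⟨ cong fromℤ (a≡a%ℕn+[a/ℕn]*n r p) ⟩
      fromℤ (+ j ℤ.+ q ℤ.* + p)    ≡⟨ fromℤ-+ (+ j) (q ℤ.* + p) ⟩
      ι j + fromℤ (q ℤ.* + p)      ≡⟨ cong (λ u → ι j + u) (fromℤ-* q (+ p)) ⟩
      ι j + fromℤ q * ι p          ∎
      where open ≡-Reasoning
    -- n w ≡ j (mod p) and d w ≡ 1 (mod p), hence x = n/d ≡ j
    rearrange : ∀ x j d w p t q n →
      x - j ≡ p * 1ℚ * (q - t * x) + (- x) * (d * w - (1ℚ + p * t))
                + w * (x * d - n) + 1ℚ * (n * w - (j + q * p))
    rearrange = solve-∀ ℚ-ring

  falling-divisible : ∀ x {N j} → InZp p x → j ℕ.< N → Cong p 1 x (ι j) → Multiple p 1 (falling x N)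
  falling-divisible x {suc N} x∈ j<1+N x≡j with ℕ.m<1+n⇒m<n∨m≡n j<1+N
  ... | inj₁ j<N = Multiple-*ʳ 1 (falling-divisible x x∈ j<N x≡j) (x - ι N) (InZp-- x (ι N) x∈ (InZp-ι N))
  ... | inj₂ refl = Multiple-*ˡ 1 {x - ι N} (falling x N) (InZp-falling x N x∈) x≡j

  falling-pred-divisible : ∀ x → InZp p x → ¬ Cong p 1 x (ι (p ∸ 1)) → Multiple p 1 (falling x (p ∸ 1))
  falling-pred-divisible x x∈ x≢p-1 = from-residue (residue x x∈)
    where
    from-residue : Σ ℕ (λ j → j ℕ.< p × Cong p 1 x (ι j)) → Multiple p 1 (falling x (p ∸ 1))
    from-residue (j , j<p , x≡j) = falling-divisible x x∈ (ℕ.≤∧≢⇒< (ℕ.<⇒≤pred j<p) j≢p-1) x≡j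
      where
      j≢p-1 : j ≢ p ∸ 1
      j≢p-1 refl = x≢p-1 x≡j

  ι-p : ι p ≡ ι (p ∸ 1) + 1ℚ
  ι-p = trans (cong ι (sym (ℕ.suc-pred p))) (ι-suc (p ∸ 1))

  p∤! : ∀ {n} → n ℕ.< p → ¬ p ∣ n !
  p∤! {zero} _ = p∤1
  p∤! {suc n} 1+n<p p∣[1+n]! =
    [ (λ p∣1+n → ℕ.<⇒≱ 1+n<p (∣⇒≤ p∣1+n)) , p∤! (ℕ.<-trans (ℕ.n<1+n n) 1+n<p) ]′
      (euclidsLemma (suc n) (n !) p-prime p∣[1+n]!)

  p∣central-binomial : ∀ {n} → n ℕ.< p → p ℕ.≤ 2 ℕ.* n → p ∣ (2 ℕ.* n) C n
  p∣central-binomial {n} n<p p≤2n =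
    [ id , (λ p∣n!n! → contradiction p∣n!n! (p∤* (p∤! n<p) (p∤! n<p))) ]′
      (euclidsLemma ((2 ℕ.* n) C n) (n ! ℕ.* n !) p-prime
        (subst (p ∣_) (sym (central-binomial n)) (∣-trans (n∣n! p) (m≤n⇒m!∣n! p≤2n))))

  p∸1<p : p ∸ 1 ℕ.< p
  p∸1<p = subst (p ∸ 1 ℕ.<_) (ℕ.suc-pred p) (ℕ.n<1+n (p ∸ 1))

  ≢-1⇒≢p-1 : ∀ a → ¬ Cong p 1 a (- 1ℚ) → ¬ Cong p 1 a (ι (p ∸ 1))
  ≢-1⇒≢p-1 a a≢-1 a≡p-1 =
    a≢-1 (Multiple-≡ 1 (trans (cong (λ P → a - ι (p ∸ 1) + P) ι-p) (shift a (ι (p ∸ 1))))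
                       (Multiple-+ 1 {a - ι (p ∸ 1)} {ι p} a≡p-1 (Multiple-ι (ℕ∣.∣-refl {p}))))
    where
    shift : ∀ a n → a - n + (n + 1ℚ) ≡ a - - 1ℚ
    shift = solve-∀ ℚ-ring

  ≢0⇒-1-≢p-1 : ∀ a → ¬ Cong p 1 a 0ℚ → ¬ Cong p 1 (- 1ℚ - a) (ι (p ∸ 1))
  ≢0⇒-1-≢p-1 a a≢0 b≡p-1 =
    a≢0 (Multiple-≡ 1 (trans (cong (λ P → - 1ℚ * (- 1ℚ - a - ι (p ∸ 1) + P)) ι-p) (reflect a (ι (p ∸ 1))))
                      (Multiple-*ˡ 1 {x = - 1ℚ - a - ι (p ∸ 1) + ι p} (- 1ℚ) (InZp-neg 1ℚ (InZp-ι 1))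
                        (Multiple-+ 1 {x = - 1ℚ - a - ι (p ∸ 1)} {ι p} b≡p-1 (Multiple-ι (ℕ∣.∣-refl {p})))))
    where
    reflect : ∀ a n → - 1ℚ * (- 1ℚ - a - n + (n + 1ℚ)) ≡ a - 0ℚ
    reflect = solve-∀ ℚ-ring

  binom-divisible : ∀ x → InZp p x → ¬ Cong p 1 x (ι (p ∸ 1)) → Multiple p 1 (binom x (p ∸ 1))
  binom-divisible x x∈ x≢p-1 =
    Multiple-*ʳ 1 (falling-pred-divisible x x∈ x≢p-1) (inv (ι ((p ∸ 1) !))) (InZp-inv-ι (p∤! p∸1<p))

  c-divisible : ∀ a m → InZp p a → InZp p m → ¬ Cong p 1 m 0ℚ → ¬ Cong p 1 a 0ℚ → ¬ Cong p 1 a (- 1ℚ) →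
                p ℕ.≤ 2 ℕ.* (p ∸ 1) → Multiple p 3 (c a (p ∸ 1) ÷ m ^ (p ∸ 1))
  c-divisible a m a∈ m∈ m≢0 a≢0 a≢-1 p≤2[p-1] =
    Multiple-*ʳ 3 (Multiple-* 2 1 (Multiple-* 1 1 (binom-divisible a a∈ (≢-1⇒≢p-1 a a≢-1))
                                                   (binom-divisible (- 1ℚ - a) b∈ (≢0⇒-1-≢p-1 a a≢0)))
                                  (Multiple-ι (p∣central-binomial p∸1<p p≤2[p-1])))
                  (inv (m ^ (p ∸ 1))) inv-mᵖ⁻¹∈
    where
    b∈ : InZp p (- 1ℚ - a)
    b∈ = InZp-- (- 1ℚ) a (InZp-neg 1ℚ (InZp-ι 1)) a∈
    inv-mᵖ⁻¹∈ : InZp p (inv (m ^ (p ∸ 1)))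
    inv-mᵖ⁻¹∈ = subst (InZp p) (sym (inv-^ m (p ∸ 1))) (InZp-^ (inv m) (p ∸ 1) (InZp-inv m m∈ m≢0))

theorem4p1 : (p : ℕ) → Prime p → p ≢ 2 → (a m : ℚ) → InZp p a → InZp p m →
    ¬ Cong p 1 m 0ℚ → ¬ Cong p 1 a 0ℚ → ¬ Cong p 1 a (- 1ℚ) →
    Cong p 3
      (ι 2 * a * (a + 1ℚ) * sumTo (p ∸ 1) (λ k → c a k ÷ (m ^ k * (ι (ℕ.suc k) ^ 2))))
      ((m - ι 4) * sumTo p (λ k → ι k * c a k ÷ m ^ k)
        + ι 2 * sumTo p (λ k → c a k ÷ m ^ k)
        + (ι 4 * a * (a + 1ℚ) - ι 2) * sumTo (p ∸ 1) (λ k → c a k ÷ (m ^ k * ι (ℕ.suc k))))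
    ×
    Cong p 3
      (ι 2 * a * (a + 1ℚ) * sumTo (p ∸ 1) (λ k → c a k ÷ (m ^ k * (ι (ℕ.suc k) ^ 3))))
      (- m
        + (ι 2 * m - ι 8 - (m - ι 4) ÷ (a * (a + 1ℚ))) * sumTo p (λ k → ι k * c a k ÷ m ^ k)
        + (m - ι 2 ÷ (a * (a + 1ℚ))) * sumTo p (λ k → c a k ÷ m ^ k)
        + (ι 8 * a * (a + 1ℚ) - ι 2 + ι 2 ÷ (a * (a + 1ℚ)))
            * sumTo (p ∸ 1) (λ k → c a k ÷ (m ^ k * ι (ℕ.suc k))))
theorem4p1 zero ()
theorem4p1 (suc zero) ()
theorem4p1 p@(suc (suc n)) p-prime _ a m a∈ m∈ m≢0 a≢0 a≢-1 =
  Multiple-≡ 3 (sym (defect₁-closed a m m≢0ℚ N)) (Multiple-*ˡ 3 {T} e₁ e₁∈ p³∣T) ,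
  Multiple-≡ 3 (sym (defect₂-closed a m m≢0ℚ A≢0 N)) (Multiple-*ˡ 3 {T} e₂ e₂∈ p³∣T)
  where
  open Padic p-prime
  N : ℕ
  N = suc n
  m≢0ℚ : m ≢ 0ℚ
  m≢0ℚ = ¬Cong⇒≢0 1 m m≢0
  T : ℚ
  T = c a N ÷ m ^ N
  p³∣T : Multiple p 3 T
  p³∣T = c-divisible a m a∈ m∈ m≢0 a≢0 a≢-1
    (subst (p ℕ.≤_) (sym (ℕ.*-suc 2 n)) (ℕ.s≤s (ℕ.s≤s (ℕ.m≤m+n n (n ℕ.+ 0)))))
  a+1≢0 : ¬ Cong p 1 (a + 1ℚ) 0ℚ
  a+1≢0 a+1≡0 = a≢-1 (Multiple-≡ 1 (shift a) a+1≡0)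
    where
    shift : ∀ a → a + 1ℚ - 0ℚ ≡ a - - 1ℚ
    shift = solve-∀ ℚ-ring
  A≢0 : a * (a + 1ℚ) ≢ 0ℚ
  A≢0 = *-≢0 a (a + 1ℚ) (¬Cong⇒≢0 1 a a≢0) (¬Cong⇒≢0 1 (a + 1ℚ) a+1≢0)
  i : ℚ
  i = inv (a * (a + 1ℚ))
  i∈ : InZp p i
  i∈ = subst (InZp p) (sym (inv-* a (a + 1ℚ))) (InZp-* (inv a) (inv (a + 1ℚ)) (InZp-inv a a∈ a≢0)
         (InZp-inv (a + 1ℚ) (InZp-+ a 1ℚ a∈ (InZp-ι 1)) a+1≢0))
  e₁ : ℚ
  e₁ = ι 4 * ι N - ι 2
  e₁∈ : InZp p e₁
  e₁∈ = InZp-- (ι 4 * ι N) (ι 2) (InZp-* (ι 4) (ι N) (InZp-ι 4) (InZp-ι N)) (InZp-ι 2)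
  e₂ : ℚ
  e₂ = ι 8 * ι N - e₁ * i
  e₂∈ : InZp p e₂
  e₂∈ = InZp-- (ι 8 * ι N) (e₁ * i) (InZp-* (ι 8) (ι N) (InZp-ι 8) (InZp-ι N)) (InZp-* e₁ i e₁∈ i∈)
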